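{- For every sequence $u$, $dfw(u) = fw(red(u))$.
   Context: For a sequence $S$, $S$ contains $u$ if some subsequence of $S$ is isomorphic to $u$ (obtained from $u$ by an injective renaming of letters). An $(r,s)$-formation is a concatenation of $s$ permutations of the same $r$ symbols; $fw(u)$ is the minimum $s$ for which there exists $r$ such that every $(r,s)$-formation contains $u$. A $j$-fat permutation on $r$ symbols is a sequence with $r$ distinct letters, each occurring exactly $j$ times; a $j$-tuple $(r,s)$-formation is a concatenation of $s$ $j$-fat permutations on the same $r$ symbols. $dfw(u)$ is the minimum $s$ for which there exists $r$ such that every $r$-tuple $(r,s)$-formation contains $u$. $red(u)$ is the sequence obtained from $u$ by replacing every maximal block of adjacent equal letters by a single occurrence of that letter. -}

module Defs where

open import Data.Nat using (ℕ; _≤_; _≟_)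
open import Data.List using (List; []; _∷_; map; concat; length; concatMap; replicate)
open import Data.List.Membership.Propositional using (_∈_)
open import Data.List.Relation.Unary.All using (All)
open import Data.List.Relation.Unary.Unique.Propositional using (Unique)
open import Data.List.Relation.Binary.Sublist.Propositional using (_⊆_)
open import Data.List.Relation.Binary.Permutation.Propositional using (_↭_)
open import Data.Product using (Σ; ∃; _×_; _,_)
open import Relation.Binary.PropositionalEquality using (_≡_)
open import Relation.Nullary using (yes; no)

Seq : Set
Seq = List ℕ

Contains : Seq → Seq → Set
Contains S u = Σ (ℕ → ℕ) λ f →
  (∀ x y → x ∈ u → y ∈ u → f x ≡ f y → x ≡ y) × (map f u ⊆ S)

IsPermOf : Seq → Seq → Set
IsPermOf X p = p ↭ X

-- A j-fat permutation on the distinct symbols listed in X: each symbol of X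
-- occurs exactly j times, and no other symbol occurs.
IsFatPermOf : ℕ → Seq → Seq → Set
IsFatPermOf j X p = p ↭ concatMap (replicate j) X

IsFormation : ℕ → ℕ → Seq → Set
IsFormation r s S = Σ Seq λ X → Unique X × length X ≡ r ×
  Σ (List Seq) λ bs → length bs ≡ s × All (IsPermOf X) bs × S ≡ concat bs

IsTupleFormation : ℕ → ℕ → ℕ → Seq → Set
IsTupleFormation j r s S = Σ Seq λ X → Unique X × length X ≡ r ×
  Σ (List Seq) λ bs → length bs ≡ s × All (IsFatPermOf j X) bs × S ≡ concat bs

FwProp : Seq → ℕ → Set
FwProp u s = ∃ λ r → ∀ S → IsFormation r s S → Contains S u

DfwProp : Seq → ℕ → Set
DfwProp u s = ∃ λ r → ∀ S → IsTupleFormation r r s S → Contains S u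

IsFw : Seq → ℕ → Set
IsFw u s = FwProp u s × (∀ t → FwProp u t → s ≤ t)

IsDfw : Seq → ℕ → Set
IsDfw u s = DfwProp u s × (∀ t → DfwProp u t → s ≤ t)

red : Seq → Seq
red [] = []
red (x ∷ xs) = go x xs
  where
  go : ℕ → Seq → Seq
  go x [] = x ∷ []
  go x (y ∷ ys) with x ≟ y
  ... | yes _ = go y ys
  ... | no _ = x ∷ go y ys

module Submission where

-- Write  blow k S  for S with every letter repeated k times.  Both directions
-- transfer witnesses between formations and fat formations through blow:
--
--  * dfw ⇒ fw.  Blowing up an (r,s)-formation by r gives an r-tuple
--    (r,s)-formation.  If  blow r S  contains u, then S contains red u,
--    because red turns a subsequence of  blow r S  into a subsequence of S
--    and commutes with renamings that are injective on u.
--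
--  * fw ⇒ dfw.  Let k = |u| + 1.  In a (k·r)-fat permutation on k·r symbols,
--    fix r of the symbols; a greedy scan (cut the block where some fixed
--    symbol first reaches k occurrences, keep that symbol, recurse on the rest)
--    extracts a permutation p of them with  blow k p  a subsequence of the
--    block.  So every (k·r)-tuple (k·r,s)-formation contains  blow k S  for an
--    (r,s)-formation S, which contains red u, hence  blow k S  contains u
--    because u is a subsequence of  blow k (red u)  when |u| ≤ k.

open import Defs
open import Data.Nat
open import Data.Nat.Properties
open import Data.List using (List; []; _∷_; [_]; map; concat; length; concatMap; replicate; filter; take; _++_)
open import Data.List.Properties using (concatMap-++; concatMap-cong; concatMap-map; map-concatMap; map-replicate; length-map; length-take; length-replicate; length-filter; filter-++; filter-all; filter-accept; filter-reject; ++-assoc; ++-identityʳ; length-++)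
open import Data.List.Reverse using (Reverse; []; _∶_∶ʳ_; reverseView)
open import Data.List.Membership.Propositional using (_∈_; find; lose)
open import Data.List.Membership.Propositional.Properties using (∈-∃++)
open import Data.List.Relation.Unary.Any using (Any; here; there; any?)
open import Data.List.Relation.Unary.All using (All; []; _∷_)
import Data.List.Relation.Unary.All as All
open import Data.List.Relation.Unary.All.Properties using (replicate⁺; map⁺)
open import Data.List.Relation.Unary.Unique.Propositional.Properties using (take⁺)
open import Data.List.Relation.Binary.Sublist.Propositional using (_⊆_; []; _∷_; _∷ʳ_; minimum; ⊆-refl; ⊆-trans)
open import Data.List.Relation.Binary.Sublist.Propositional.Properties using (++⁺; Any-resp-⊆; take-⊆) renaming (map⁺ to map⁺-⊆)
open import Data.List.Relation.Binary.Permutation.Propositional using (_↭_; prep; swap; ↭-sym; ↭-trans; ↭-reflexive; module PermutationReasoning) renaming (refl to ↭-refl; trans to ↭-step)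
open import Data.List.Relation.Binary.Permutation.Propositional.Properties using (++⁺ˡ; ++-comm; ↭-length; ∈-resp-↭; filter-↭; shift) renaming (++⁺ to ++⁺-↭)
open import Data.Product using (Σ; ∃; _×_; _,_; proj₁; proj₂)
open import Function using (_∘_)
open import Relation.Binary.PropositionalEquality using (_≡_; _≢_; refl; sym; trans; cong; subst; module ≡-Reasoning)
open import Relation.Nullary using (yes; no)
open import Data.Empty using (⊥-elim)

blow : ℕ → Seq → Seq
blow k = concatMap (replicate k)

blow-concat : ∀ k (bs : List Seq) → blow k (concat bs) ≡ concat (map (blow k) bs)
blow-concat k [] = refl
blow-concat k (b ∷ bs) = trans (concatMap-++ (replicate k) b (concat bs)) (cong (blow k b ++_) (blow-concat k bs))

blow-↭ : ∀ k {A B} → A ↭ B → blow k A ↭ blow k B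
blow-↭ k ↭-refl = ↭-refl
blow-↭ k (prep x p) = ++⁺ˡ (replicate k x) (blow-↭ k p)
blow-↭ k (swap {xs} {ys} x y p) = begin
  replicate k x ++ replicate k y ++ blow k xs    ≡⟨ sym (++-assoc (replicate k x) _ _) ⟩
  (replicate k x ++ replicate k y) ++ blow k xs  ↭⟨ ++⁺-↭ (++-comm (replicate k x) (replicate k y)) (blow-↭ k p) ⟩
  (replicate k y ++ replicate k x) ++ blow k ys  ≡⟨ ++-assoc (replicate k y) _ _ ⟩
  replicate k y ++ replicate k x ++ blow k ys    ∎
  where open PermutationReasoning
blow-↭ k (↭-step p q) = ↭-trans (blow-↭ k p) (blow-↭ k q)

blow-⊆ : ∀ k {A B} → A ⊆ B → blow k A ⊆ blow k B
blow-⊆ k [] = []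
blow-⊆ k (y ∷ʳ p) = ++⁺ (minimum (replicate k y)) (blow-⊆ k p)
blow-⊆ k (refl ∷ p) = ++⁺ ⊆-refl (blow-⊆ k p)

map-blow : ∀ (g : ℕ → ℕ) k L → map g (blow k L) ≡ blow k (map g L)
map-blow g k L = begin
  map g (blow k L)                   ≡⟨ map-concatMap g (replicate k) L ⟩
  concatMap (map g ∘ replicate k) L  ≡⟨ concatMap-cong (map-replicate g k) L ⟩
  concatMap (replicate k ∘ g) L      ≡⟨ sym (concatMap-map (replicate k) g L) ⟩
  blow k (map g L)                   ∎
  where open ≡-Reasoning

occ : ℕ → Seq → ℕ
occ y T = length (filter (y ≟_) T)

occ-++ : ∀ y A B → occ y (A ++ B) ≡ occ y A + occ y B
occ-++ y A B = trans (cong length (filter-++ (y ≟_) A B)) (length-++ (filter (y ≟_) A))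

occ-↭ : ∀ y {A B} → A ↭ B → occ y A ≡ occ y B
occ-↭ y p = ↭-length (filter-↭ (y ≟_) p)

occ-blow : ∀ y j X → y ∈ X → j ≤ occ y (blow j X)
occ-blow y j (x ∷ X) (here refl) rewrite occ-++ y (replicate j y) (blow j X) =
  ≤-trans (≤-reflexive (sym own)) (m≤m+n (occ y (replicate j y)) _)
  where
  own : occ y (replicate j y) ≡ j
  own = trans (cong length (filter-all (y ≟_) (replicate⁺ j refl))) (length-replicate j)
occ-blow y j (x ∷ X) (there y∈X) rewrite occ-++ y (replicate j x) (blow j X) =
  ≤-trans (occ-blow y j X y∈X) (m≤n+m _ _)

fat-occ : ∀ {j X b y} → IsFatPermOf j X b → y ∈ X → j ≤ occ y b
fat-occ {j} {X} {b} {y} b↭ y∈X = subst (j ≤_) (sym (occ-↭ y b↭)) (occ-blow y j X y∈X)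

replicate-⊆ : ∀ {n} x T → n ≤ occ x T → replicate n x ⊆ T
replicate-⊆ {zero} x T _ = minimum T
replicate-⊆ {suc n} x [] ()
replicate-⊆ {suc n} x (t ∷ T) le with x ≟ t
... | yes x≡t = x≡t ∷ replicate-⊆ x T (s≤s⁻¹ (subst (suc n ≤_) (cong length (filter-accept (x ≟_) x≡t)) le))
... | no x≢t = t ∷ʳ replicate-⊆ x T (subst (suc n ≤_) (cong length (filter-reject (x ≟_) x≢t)) le)

record Cut (k : ℕ) (Y T : Seq) : Set where
  field
    x : ℕ
    before after : Seq
    splits : T ≡ before ++ after
    x∈Y : x ∈ Y
    reached : k ≤ occ x before
    bounded : ∀ y → y ∈ Y → occ y before ≤ k

-- Scanning
-- T from the right: if the cut already exists in T without its last letter,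
-- extend it; otherwise cut after the last letter.
cut : ∀ k Y {T} → Reverse T → Any (λ y → k ≤ occ y T) Y → Cut k Y T
cut k Y [] some with find some
... | x , x∈Y , k≤0 = record
  { x = x ; before = [] ; after = [] ; splits = refl ; x∈Y = x∈Y
  ; reached = k≤0 ; bounded = λ _ _ → z≤n }
cut k Y (T ∶ rv ∶ʳ t) some with any? (λ y → k ≤? occ y T) Y
... | yes early = record
  { x = x ; before = before ; after = after ++ [ t ]
  ; splits = trans (cong (_++ [ t ]) splits) (++-assoc before after [ t ])
  ; x∈Y = x∈Y ; reached = reached ; bounded = bounded }
  where open Cut (cut k Y rv early)
... | no none with find some
... | x , x∈Y , reached = record
  { x = x ; before = T ++ [ t ] ; after = [] ; splits = sym (++-identityʳ _)
  ; x∈Y = x∈Y ; reached = reached ; bounded = bounded }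
  where
  bounded : ∀ y → y ∈ Y → occ y (T ++ [ t ]) ≤ k
  bounded y y∈Y = begin
    occ y (T ++ [ t ])       ≡⟨ occ-++ y T [ t ] ⟩
    occ y T + occ y [ t ]    ≤⟨ +-monoʳ-≤ (occ y T) (length-filter (y ≟_) [ t ]) ⟩
    occ y T + 1              ≡⟨ +-comm (occ y T) 1 ⟩
    suc (occ y T)            ≤⟨ ≰⇒> (λ k≤occ → none (lose y∈Y k≤occ)) ⟩
    k                        ∎
    where open ≤-Reasoning

remove : ∀ {x : ℕ} {Y} → x ∈ Y → ∃ λ Y' → Y ↭ x ∷ Y'
remove {x} x∈Y with ∈-∃++ x∈Y
... | A , B , Y≡ = A ++ B , ↭-trans (↭-reflexive Y≡) (shift x A B)

leftover : ∀ k m {a b} → k + m ≤ a + b → a ≤ k → m ≤ b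
leftover k m {a} {b} le a≤k = +-cancelˡ-≤ k m b (≤-trans le (+-monoˡ-≤ b a≤k))

-- Cut T where some x ∈ Y first reaches k occurrences; the other letters lose
-- at most k occurrences to the part before the cut, so recurse on the rest.
extract : ∀ k n Y T → length Y ≡ n → (∀ y → y ∈ Y → k * n ≤ occ y T) →
          ∃ λ p → p ↭ Y × blow k p ⊆ T
extract k zero [] T _ _ = [] , ↭-refl , minimum T
extract k (suc n) (y ∷ Y) T len frequent =
  let p , p↭Y' , p⊆after = extract k n Y' after (suc-injective (trans (sym (↭-length Y↭)) len)) frequent-after
  in x ∷ p , ↭-trans (prep x p↭Y') (↭-sym Y↭) ,
     subst (blow k (x ∷ p) ⊆_) (sym splits) (++⁺ (replicate-⊆ x before reached) p⊆after)
  where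
  open Cut (cut k (y ∷ Y) (reverseView T) (here (≤-trans (m≤m*n k (suc n)) (frequent y (here refl)))))
  Y' : Seq
  Y' = proj₁ (remove x∈Y)
  Y↭ : y ∷ Y ↭ x ∷ Y'
  Y↭ = proj₂ (remove x∈Y)
  frequent-after : ∀ z → z ∈ Y' → k * n ≤ occ z after
  frequent-after z z∈Y' = leftover k (k * n) (begin
    k + k * n                     ≡⟨ sym (*-suc k n) ⟩
    k * suc n                     ≤⟨ frequent z z∈Y ⟩
    occ z T                       ≡⟨ cong (occ z) splits ⟩
    occ z (before ++ after)       ≡⟨ occ-++ z before after ⟩
    occ z before + occ z after    ∎) (bounded z z∈Y)
    where
    open ≤-Reasoning
    z∈Y : z ∈ y ∷ Y
    z∈Y = ∈-resp-↭ (↭-sym Y↭) (there z∈Y')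

red-⊆ : ∀ u → red u ⊆ u
red-⊆ [] = []
red-⊆ (x ∷ xs) = from x xs
  where
  from : ∀ x xs → red (x ∷ xs) ⊆ x ∷ xs
  from x [] = ⊆-refl
  from x (y ∷ ys) with x ≟ y
  ... | yes refl = x ∷ʳ from x ys
  ... | no _ = refl ∷ from y ys

∈-red⁺ : ∀ u {a} → a ∈ u → a ∈ red u
∈-red⁺ (x ∷ xs) = from x xs
  where
  from : ∀ x xs {a} → a ∈ x ∷ xs → a ∈ red (x ∷ xs)
  from x [] a∈ = a∈
  from x (y ∷ ys) a∈ with x ≟ y | a∈
  ... | yes refl | here a≡x = from x ys (here a≡x)
  ... | yes refl | there a∈ys = from x ys a∈ys
  ... | no _ | here a≡x = here a≡x
  ... | no _ | there a∈ys = there (from y ys a∈ys)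

InjectiveOn : (ℕ → ℕ) → Seq → Set
InjectiveOn f u = ∀ x y → x ∈ u → y ∈ u → f x ≡ f y → x ≡ y

injectiveOn-⊇ : ∀ {f u v} → (∀ {a} → a ∈ v → a ∈ u) → InjectiveOn f u → InjectiveOn f v
injectiveOn-⊇ v⊆u inj a b a∈v b∈v = inj a b (v⊆u a∈v) (v⊆u b∈v)

-- red commutes with renamings that are injective on the letters: they neither
-- create nor destroy equalities between adjacent letters.
red-map : ∀ f u → InjectiveOn f u → red (map f u) ≡ map f (red u)
red-map f [] _ = refl
red-map f (x ∷ xs) = from x xs
  where
  from : ∀ x xs → InjectiveOn f (x ∷ xs) → red (map f (x ∷ xs)) ≡ map f (red (x ∷ xs))
  from x [] _ = refl
  from x (y ∷ ys) inj with x ≟ y | f x ≟ f y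
  ... | yes refl | yes _ = from x ys (injectiveOn-⊇ there inj)
  ... | yes refl | no fx≢fx = ⊥-elim (fx≢fx refl)
  ... | no x≢y | yes fx≡fy = ⊥-elim (x≢y (inj x y (here refl) (there (here refl)) fx≡fy))
  ... | no _ | no _ = cong (f x ∷_) (from y ys (injectiveOn-⊇ there inj))

skip-block : ∀ m {v y : ℕ} {ws} B → y ∷ ws ⊆ replicate m v ++ B → y ≢ v → y ∷ ws ⊆ B
skip-block zero B p _ = p
skip-block (suc m) B (_ ∷ʳ p) y≢v = skip-block m B p y≢v
skip-block (suc m) B (y≡v ∷ _) y≢v = ⊥-elim (y≢v y≡v)

-- red maps subsequences of  blow r V  to subsequences of V: each run of equal
-- letters of w is matched inside a single block of copies of one letter of V.
red-⊆-blow : ∀ r w V → w ⊆ blow r V → red w ⊆ V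

-- The invariant: the first letter of x ∷ w is matched within the remaining m
-- copies of v, which are followed by  blow r V.
red-⊆-blow-from : ∀ r m v V x w → x ∷ w ⊆ replicate m v ++ blow r V → red (x ∷ w) ⊆ v ∷ V
red-⊆-blow-from r zero v V x w p = v ∷ʳ red-⊆-blow r (x ∷ w) V p
red-⊆-blow-from r (suc m) v V x w (_ ∷ʳ p) = red-⊆-blow-from r m v V x w p
red-⊆-blow-from r (suc m) v V x [] (x≡v ∷ _) = x≡v ∷ minimum V
red-⊆-blow-from r (suc m) v V x (y ∷ ys) (x≡v ∷ p) with x ≟ y
... | yes refl = red-⊆-blow-from r m v V x ys p
... | no x≢y = x≡v ∷ red-⊆-blow r (y ∷ ys) V
                 (skip-block m (blow r V) p (λ y≡v → x≢y (trans x≡v (sym y≡v))))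

red-⊆-blow r [] V _ = minimum V
red-⊆-blow r (x ∷ w) [] ()
red-⊆-blow r (x ∷ w) (v ∷ V) p = red-⊆-blow-from r r v V x w p

replicate-mono : ∀ {a b} (x : ℕ) → a ≤ b → replicate a x ⊆ replicate b x
replicate-mono {b = b} x z≤n = minimum (replicate b x)
replicate-mono x (s≤s a≤b) = refl ∷ replicate-mono x a≤b

replicate-snoc : ∀ j (x : ℕ) L → replicate j x ++ x ∷ L ≡ replicate (suc j) x ++ L
replicate-snoc zero x L = refl
replicate-snoc (suc j) x L = cong (x ∷_) (replicate-snoc j x L)

-- The run-by-run embedding: with j copies of x already placed at the start of
-- the current run, the whole of  x^j x xs  embeds in  blow k (red (x ∷ xs)).
⊆-blow-red-from : ∀ k j x xs → j + length (x ∷ xs) ≤ k → replicate j x ++ x ∷ xs ⊆ blow k (red (x ∷ xs))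
⊆-blow-red-from k j x [] le rewrite replicate-snoc j x [] =
  ++⁺ (replicate-mono x (≤-trans (m<m+n j (s≤s z≤n)) le)) []
⊆-blow-red-from k j x (y ∷ ys) le with x ≟ y
... | yes refl rewrite replicate-snoc j x (x ∷ ys) =
  ⊆-blow-red-from k (suc j) x ys (subst (_≤ k) (+-suc j (suc (length ys))) le)
... | no _ rewrite replicate-snoc j x (y ∷ ys) =
  ++⁺ (replicate-mono x (≤-trans (m<m+n j (s≤s z≤n)) le))
      (⊆-blow-red-from k 0 y ys (≤-trans (≤-trans (n≤1+n _) (m≤n+m _ j)) le))

-- Conversely u is a subsequence of  blow k (red u)  when |u| ≤ k, since then
-- every run of u has length at most k.
⊆-blow-red : ∀ k u → length u ≤ k → u ⊆ blow k (red u)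
⊆-blow-red k [] _ = []
⊆-blow-red k (x ∷ xs) le = ⊆-blow-red-from k 0 x xs le

contains-⊆ : ∀ {S T u} → S ⊆ T → Contains S u → Contains T u
contains-⊆ S⊆T (f , inj , fu⊆S) = f , inj , ⊆-trans fu⊆S S⊆T

contains-blow⁻ : ∀ r {S} u → Contains (blow r S) u → Contains S (red u)
contains-blow⁻ r {S} u (f , inj , fu⊆) =
  f , injectiveOn-⊇ (Any-resp-⊆ (red-⊆ u)) inj ,
  subst (_⊆ S) (red-map f u inj) (red-⊆-blow r (map f u) S fu⊆)

contains-blow⁺ : ∀ k {S} u → length u ≤ k → Contains S (red u) → Contains (blow k S) u
contains-blow⁺ k {S} u le (g , inj , gr⊆S) =
  g , injectiveOn-⊇ (∈-red⁺ u) inj ,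
  ⊆-trans (map⁺-⊆ g (⊆-blow-red k u le))
          (subst (_⊆ blow k S) (sym (map-blow g k (red u))) (blow-⊆ k gr⊆S))

blow-formation : ∀ j {r s S} → IsFormation r s S → IsTupleFormation j r s (blow j S)
blow-formation j (X , uniq , lenX , bs , lenbs , perms , refl) =
  X , uniq , lenX , map (blow j) bs , trans (length-map (blow j) bs) lenbs ,
  map⁺ (All.map (blow-↭ j) perms) , blow-concat j bs

thin-blocks : ∀ k n Y → length Y ≡ n → (bs : List Seq) →
  All (λ b → ∀ y → y ∈ Y → k * n ≤ occ y b) bs →
  Σ (List Seq) λ ps → length ps ≡ length bs × All (IsPermOf Y) ps × blow k (concat ps) ⊆ concat bs
thin-blocks k n Y lenY [] [] = [] , refl , [] , []
thin-blocks k n Y lenY (b ∷ bs) (freq ∷ freqs)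
  with extract k n Y b lenY freq | thin-blocks k n Y lenY bs freqs
... | p , p↭Y , p⊆b | ps , lenps , perms , ps⊆bs =
  p ∷ ps , cong suc lenps , p↭Y ∷ perms ,
  subst (_⊆ b ++ concat bs) (sym (concatMap-++ (replicate k) p (concat ps))) (++⁺ p⊆b ps⊆bs)

length-take≤ : ∀ r (X : Seq) → r ≤ length X → length (take r X) ≡ r
length-take≤ r X r≤ = trans (length-take r X) (m≤n⇒m⊓n≡m r≤)

-- Every j-tuple (R,s)-formation with r ≤ R and k·r ≤ j contains  blow k S'
-- for some (r,s)-formation S' (on the first r symbols), since each of those
-- symbols occurs j ≥ k·r times in every block.
thin-formation : ∀ r k {j R s S} → r ≤ R → k * r ≤ j → IsTupleFormation j R s S →
  ∃ λ S' → IsFormation r s S' × blow k S' ⊆ S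
thin-formation r k r≤R kr≤j (X , uniq , refl , bs , lenbs , fats , refl)
  with thin-blocks k r (take r X) (length-take≤ r X r≤R) bs
         (All.map (λ b↭ y y∈Y → ≤-trans kr≤j (fat-occ b↭ (Any-resp-⊆ (take-⊆ r X) y∈Y))) fats)
... | ps , lenps , perms , ps⊆bs =
  concat ps , (take r X , take⁺ r uniq , length-take≤ r X r≤R , ps , trans lenps lenbs , perms , refl) , ps⊆bs

dfw⇒fw : ∀ u s → DfwProp u s → FwProp (red u) s
dfw⇒fw u s (r , contains) =
  r , λ S formation → contains-blow⁻ r u (contains (blow r S) (blow-formation r formation))

fw⇒dfw : ∀ u s → FwProp (red u) s → DfwProp u s
fw⇒dfw u s (r , contains) = k * r , λ S tuple →
  let S' , formation , S'⊆S = thin-formation r k (m≤n*m r k) ≤-refl tuple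
  in contains-⊆ S'⊆S (contains-blow⁺ k u (n≤1+n (length u)) (contains S' formation))
  where
  k : ℕ
  k = suc (length u)

mainTheorem3 : ∀ (u : Seq) (s : ℕ) → (IsDfw u s → IsFw (red u) s) × (IsFw (red u) s → IsDfw u s)
mainTheorem3 u s =
  (λ (dfw , least) → dfw⇒fw u s dfw , λ t fw → least t (fw⇒dfw u t fw)) ,
  (λ (fw , least) → fw⇒dfw u s fw , λ t dfw → least t (dfw⇒fw u t dfw))
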